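{- If the consecution $X\Rightarrow A$ is provable in $\mathbf{B}$, $d$ is a depth substitution and $n\in\mathbb{Z}$, then $d^n(X)\Rightarrow d^n(A)$ is provable in $\mathbf{B}$.
   Context: Atoms $p_1,p_2,\dots$; formulas built by $\neg,\land,\lor,\to,\circ$; bunches built from formulas by comma $(X,Y)$ and semicolon $(X;Y)$; a consecution is $X\Rightarrow A$. $Y(X)$ denotes $Y$ with a distinguished occurrence of subbunch $X$, $Y(Z)$ the replacement by $Z$. Depth substitution: $d:\mathbb{Z}\times\mathsf{At}\to$ formulas, written $d^n(p)$, extended by $d^n(\neg A)=\neg d^n(A)$, $d^n(A\land B)=d^n(A)\land d^n(B)$, $d^n(A\lor B)=d^n(A)\lor d^n(B)$, $d^n(A\to B)=d^{n+1}(A)\to d^{n+1}(B)$, $d^n(A\circ B)=d^{n-1}(A)\circ d^n(B)$, $d^n(X,Y)=d^n(X),d^n(Y)$, $d^n(X;Y)=d^{n-1}(X);d^n(Y)$. Rules of $\mathbf{B}$ (premises / conclusion): (id): $A\Rightarrow A$. ($\to$I): $X;A\Rightarrow B$ / $X\Rightarrow A\to B$. ($\to$E): $X\Rightarrow A\to B$, $Y\Rightarrow A$ / $X;Y\Rightarrow B$. ($\lor$I$_1$): $X\Rightarrow A$ / $X\Rightarrow A\lor B$. ($\lor$I$_2$): $X\Rightarrow B$ / $X\Rightarrow A\lor B$. ($\lor$E): $X\Rightarrow A\lor B$, $Y(A)\Rightarrow C$, $Y(B)\Rightarrow C$ / $Y(X)\Rightarrow C$. ($\land$I): $X\Rightarrow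 A$, $Y\Rightarrow B$ / $X,Y\Rightarrow A\land B$. ($\land$E): $X\Rightarrow A\land B$, $Y(A,B)\Rightarrow C$ / $Y(X)\Rightarrow C$. ($\circ$I): $X\Rightarrow A$, $Y\Rightarrow B$ / $X;Y\Rightarrow A\circ B$. ($\circ$E): $X\Rightarrow A\circ B$, $Y(A;B)\Rightarrow C$ / $Y(X)\Rightarrow C$. ($\neg$I): $X\Rightarrow B$, $A\Rightarrow\neg B$ / $X\Rightarrow\neg A$. ($\neg$E): $X\Rightarrow\neg\neg A$ / $X\Rightarrow A$. (Cut): $X\Rightarrow A$, $Y(A)\Rightarrow B$ / $Y(X)\Rightarrow B$. Structural: $W(X,(Y,Z))\Rightarrow A$ / $W((X,Y),Z)\Rightarrow A$; $W(X,Y)\Rightarrow A$ / $W(Y,X)\Rightarrow A$; $W(X,X)\Rightarrow A$ / $W(X)\Rightarrow A$; $W(X)\Rightarrow A$ / $W(X,Y)\Rightarrow A$. A consecution is provable in $\mathbf{B}$ if it is the root of a finite derivation tree built from these rules whose leaves are all (id) instances. -}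

module Defs where

open import Data.Nat using (ℕ)
open import Data.Integer using (ℤ; _+_; _-_; +_)

At : Set
At = ℕ

infixr 6 _⇒ᶠ_
infixr 7 _∨ᶠ_
infixr 8 _∧ᶠ_ _∘ᶠ_

data Fm : Set where
  atom  : At → Fm
  ¬ᶠ_   : Fm → Fm
  _∧ᶠ_  : Fm → Fm → Fm
  _∨ᶠ_  : Fm → Fm → Fm
  _⇒ᶠ_  : Fm → Fm → Fm
  _∘ᶠ_  : Fm → Fm → Fm

-- Bunches: formulas combined by comma (extensional) and semicolon (intensional).
data Bunch : Set where
  fm    : Fm → Bunch
  _,ᵇ_  : Bunch → Bunch → Bunch
  _⨾ᵇ_  : Bunch → Bunch → Bunch

data Ctx : Set where
  hole : Ctx
  _,ˡ_ : Ctx → Bunch → Ctx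
  _,ʳ_ : Bunch → Ctx → Ctx
  _⨾ˡ_ : Ctx → Bunch → Ctx
  _⨾ʳ_ : Bunch → Ctx → Ctx

_[_] : Ctx → Bunch → Bunch
hole      [ Z ] = Z
(Y ,ˡ X)  [ Z ] = (Y [ Z ]) ,ᵇ X
(X ,ʳ Y)  [ Z ] = X ,ᵇ (Y [ Z ])
(Y ⨾ˡ X)  [ Z ] = (Y [ Z ]) ⨾ᵇ X
(X ⨾ʳ Y)  [ Z ] = X ⨾ᵇ (Y [ Z ])

infix 4 _⊢_
data _⊢_ : Bunch → Fm → Set where
  id   : ∀ {A} → fm A ⊢ A
  →I   : ∀ {X A B} → (X ⨾ᵇ fm A) ⊢ B → X ⊢ (A ⇒ᶠ B)
  →E   : ∀ {X Y A B} → X ⊢ (A ⇒ᶠ B) → Y ⊢ A → (X ⨾ᵇ Y) ⊢ B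
  ∨I₁  : ∀ {X A B} → X ⊢ A → X ⊢ (A ∨ᶠ B)
  ∨I₂  : ∀ {X A B} → X ⊢ B → X ⊢ (A ∨ᶠ B)
  ∨E   : ∀ {X A B C} (Y : Ctx) → X ⊢ (A ∨ᶠ B) → Y [ fm A ] ⊢ C → Y [ fm B ] ⊢ C
         → Y [ X ] ⊢ C
  ∧I   : ∀ {X Y A B} → X ⊢ A → Y ⊢ B → (X ,ᵇ Y) ⊢ (A ∧ᶠ B)
  ∧E   : ∀ {X A B C} (Y : Ctx) → X ⊢ (A ∧ᶠ B) → Y [ fm A ,ᵇ fm B ] ⊢ C → Y [ X ] ⊢ C
  ∘I   : ∀ {X Y A B} → X ⊢ A → Y ⊢ B → (X ⨾ᵇ Y) ⊢ (A ∘ᶠ B)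
  ∘E   : ∀ {X A B C} (Y : Ctx) → X ⊢ (A ∘ᶠ B) → Y [ fm A ⨾ᵇ fm B ] ⊢ C → Y [ X ] ⊢ C
  ¬I   : ∀ {X A B} → X ⊢ B → fm A ⊢ (¬ᶠ B) → X ⊢ (¬ᶠ A)
  ¬E   : ∀ {X A} → X ⊢ (¬ᶠ (¬ᶠ A)) → X ⊢ A
  cut  : ∀ {X A B} (Y : Ctx) → X ⊢ A → Y [ fm A ] ⊢ B → Y [ X ] ⊢ B
  assoc : ∀ {X Y Z A} (W : Ctx) → W [ X ,ᵇ (Y ,ᵇ Z) ] ⊢ A → W [ (X ,ᵇ Y) ,ᵇ Z ] ⊢ A
  comm  : ∀ {X Y A} (W : Ctx) → W [ X ,ᵇ Y ] ⊢ A → W [ Y ,ᵇ X ] ⊢ A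
  contr : ∀ {X A} (W : Ctx) → W [ X ,ᵇ X ] ⊢ A → W [ X ] ⊢ A
  weak  : ∀ {X Y A} (W : Ctx) → W [ X ] ⊢ A → W [ X ,ᵇ Y ] ⊢ A

DepthSubst : Set
DepthSubst = ℤ → At → Fm

dF : DepthSubst → ℤ → Fm → Fm
dF d n (atom p)  = d n p
dF d n (¬ᶠ A)    = ¬ᶠ dF d n A
dF d n (A ∧ᶠ B)  = dF d n A ∧ᶠ dF d n B
dF d n (A ∨ᶠ B)  = dF d n A ∨ᶠ dF d n B
dF d n (A ⇒ᶠ B)  = dF d (n + + 1) A ⇒ᶠ dF d (n + + 1) B
dF d n (A ∘ᶠ B)  = dF d (n - + 1) A ∘ᶠ dF d n B

dB : DepthSubst → ℤ → Bunch → Bunch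
dB d n (fm A)    = fm (dF d n A)
dB d n (X ,ᵇ Y)  = dB d n X ,ᵇ dB d n Y
dB d n (X ⨾ᵇ Y)  = dB d (n - + 1) X ⨾ᵇ dB d n Y

{-# OPTIONS --safe #-}
-- A depth substitution commutes with plugging into
-- contexts, provided the plugged bunch is substituted at the depth of the hole,
-- so every context rule of B maps to the same rule. The only rules that change
-- depth are →I and →E, and there the shift of an implication (+1) and the
-- shift of the left of a semicolon (−1) cancel.
module Submission where

open import Defs
open import Data.Integer using (ℤ; _+_; _-_; +_; -[1+_])
open import Data.Integer.Properties using (+-assoc; +-identityʳ)
open import Relation.Binary.PropositionalEquality using (_≡_; refl; sym; trans; cong; subst)

i+1-1≡i : ∀ i → i + + 1 - + 1 ≡ i
i+1-1≡i i = trans (+-assoc i (+ 1) -[1+ 0 ]) (+-identityʳ i)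

i-1+1≡i : ∀ i → i - + 1 + + 1 ≡ i
i-1+1≡i i = trans (+-assoc i -[1+ 0 ] (+ 1)) (+-identityʳ i)

hole-depth : ℤ → Ctx → ℤ
hole-depth n hole     = n
hole-depth n (Y ,ˡ X) = hole-depth n Y
hole-depth n (X ,ʳ Y) = hole-depth n Y
hole-depth n (Y ⨾ˡ X) = hole-depth (n - + 1) Y
hole-depth n (X ⨾ʳ Y) = hole-depth n Y

module _ (d : DepthSubst) where

  dC : ℤ → Ctx → Ctx
  dC n hole     = hole
  dC n (Y ,ˡ X) = dC n Y ,ˡ dB d n X
  dC n (X ,ʳ Y) = dB d n X ,ʳ dC n Y
  dC n (Y ⨾ˡ X) = dC (n - + 1) Y ⨾ˡ dB d n X
  dC n (X ⨾ʳ Y) = dB d (n - + 1) X ⨾ʳ dC n Y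

  dB-[] : ∀ n Y Z → dB d n (Y [ Z ]) ≡ dC n Y [ dB d (hole-depth n Y) Z ]
  dB-[] n hole     Z = refl
  dB-[] n (Y ,ˡ X) Z = cong (_,ᵇ dB d n X) (dB-[] n Y Z)
  dB-[] n (X ,ʳ Y) Z = cong (dB d n X ,ᵇ_) (dB-[] n Y Z)
  dB-[] n (Y ⨾ˡ X) Z = cong (_⨾ᵇ dB d n X) (dB-[] (n - + 1) Y Z)
  dB-[] n (X ⨾ʳ Y) Z = cong (dB d (n - + 1) X ⨾ᵇ_) (dB-[] n Y Z)

  module _ (n : ℤ) (Y : Ctx) (Z : Bunch) {C : Fm} where

    dB-[]⁺ : dB d n (Y [ Z ]) ⊢ C → dC n Y [ dB d (hole-depth n Y) Z ] ⊢ C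
    dB-[]⁺ = subst (_⊢ C) (dB-[] n Y Z)

    dB-[]⁻ : dC n Y [ dB d (hole-depth n Y) Z ] ⊢ C → dB d n (Y [ Z ]) ⊢ C
    dB-[]⁻ = subst (_⊢ C) (sym (dB-[] n Y Z))

  ⊢-dB-dF : ∀ {X A} n → X ⊢ A → dB d n X ⊢ dF d n A
  ⊢-dB-dF n id      = id
  ⊢-dB-dF n (→I {X} {A} {B} p) =
    →I (subst (λ m → dB d m X ⨾ᵇ fm (dF d (n + + 1) A) ⊢ dF d (n + + 1) B)
              (i+1-1≡i n) (⊢-dB-dF (n + + 1) p))
  ⊢-dB-dF n (→E {X} {Y} {A} {B} p q) =
    →E (subst (λ m → dB d (n - + 1) X ⊢ dF d m A ⇒ᶠ dF d m B)
              (i-1+1≡i n) (⊢-dB-dF (n - + 1) p))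
       (⊢-dB-dF n q)
  ⊢-dB-dF n (∨I₁ p)  = ∨I₁ (⊢-dB-dF n p)
  ⊢-dB-dF n (∨I₂ p)  = ∨I₂ (⊢-dB-dF n p)
  ⊢-dB-dF n (∧I p q) = ∧I (⊢-dB-dF n p) (⊢-dB-dF n q)
  ⊢-dB-dF n (∘I p q) = ∘I (⊢-dB-dF (n - + 1) p) (⊢-dB-dF n q)
  ⊢-dB-dF n (¬I p q) = ¬I (⊢-dB-dF n p) (⊢-dB-dF n q)
  ⊢-dB-dF n (¬E p)   = ¬E (⊢-dB-dF n p)
  ⊢-dB-dF n (∨E {X} {A} {B} Y p q r) = dB-[]⁻ n Y X
    (∨E (dC n Y) (⊢-dB-dF (hole-depth n Y) p)
        (dB-[]⁺ n Y (fm A) (⊢-dB-dF n q)) (dB-[]⁺ n Y (fm B) (⊢-dB-dF n r)))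
  ⊢-dB-dF n (∧E {X} {A} {B} Y p q) = dB-[]⁻ n Y X
    (∧E (dC n Y) (⊢-dB-dF (hole-depth n Y) p) (dB-[]⁺ n Y (fm A ,ᵇ fm B) (⊢-dB-dF n q)))
  ⊢-dB-dF n (∘E {X} {A} {B} Y p q) = dB-[]⁻ n Y X
    (∘E (dC n Y) (⊢-dB-dF (hole-depth n Y) p) (dB-[]⁺ n Y (fm A ⨾ᵇ fm B) (⊢-dB-dF n q)))
  ⊢-dB-dF n (cut {X} {A} Y p q) = dB-[]⁻ n Y X
    (cut (dC n Y) (⊢-dB-dF (hole-depth n Y) p) (dB-[]⁺ n Y (fm A) (⊢-dB-dF n q)))
  ⊢-dB-dF n (assoc {X} {Y} {Z} W p) = dB-[]⁻ n W ((X ,ᵇ Y) ,ᵇ Z)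
    (assoc (dC n W) (dB-[]⁺ n W (X ,ᵇ (Y ,ᵇ Z)) (⊢-dB-dF n p)))
  ⊢-dB-dF n (comm {X} {Y} W p) = dB-[]⁻ n W (Y ,ᵇ X)
    (comm (dC n W) (dB-[]⁺ n W (X ,ᵇ Y) (⊢-dB-dF n p)))
  ⊢-dB-dF n (contr {X} W p) = dB-[]⁻ n W X
    (contr (dC n W) (dB-[]⁺ n W (X ,ᵇ X) (⊢-dB-dF n p)))
  ⊢-dB-dF n (weak {X} {Y} W p) = dB-[]⁻ n W (X ,ᵇ Y)
    (weak (dC n W) (dB-[]⁺ n W X (⊢-dB-dF n p)))

corollary22 : (X : Bunch) (A : Fm) (d : DepthSubst) (n : ℤ)
    → X ⊢ A → dB d n X ⊢ dF d n A
corollary22 X A d n = ⊢-dB-dF d n
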